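{- Consider the transitive triple, i.e. the digraph on vertices $x,y,z$ with arcs $x\to y$, $y\to z$, $x\to z$, carrying $g_1$ green pebbles on the source $x$, $g_2$ on $y$ and $g_3$ on the sink $z$ (and no other pebbles). This \textsc{blocking pebbles} position is a $\mathcal{P}$-position if and only if $g_2=g_3$.
   Context: \textsc{Blocking pebbles} with green pebbles only is an impartial game on a finite directed acyclic graph with a number of (green) pebbles on each vertex. A move by either player: choose a vertex $v$ and either (1) move a positive number of pebbles from $v$ to a single in-neighbour $u$ of $v$ (arc $u\to v$) at no cost, or (2) remove two pebbles from $v$ and place one pebble on an out-neighbour $w$ of $v$ (arc $v\to w$). Normal play (last player to move wins). A $\mathcal{P}$-position is one from which the player who is not to move (the previous player) wins. -}

module Defs where

open import Data.Nat using (ℕ; zero; suc; _+_; _∸_; _≤_)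
open import Data.Fin using (Fin; zero; suc; _≟_)
open import Relation.Nullary using (yes; no)
open import Data.Product using (Σ; _,_)

-- A position of (green-only) Blocking Pebbles on a digraph with vertex set Fin n:
-- the number of green pebbles on each vertex.
Position : ℕ → Set
Position n = Fin n → ℕ

Digraph : ℕ → Set₁
Digraph n = Fin n → Fin n → Set

set : ∀ {n} → Fin n → ℕ → Position n → Position n
set v m p x with x ≟ v
... | yes _ = m
... | no  _ = p x

-- (1) move k ≥ 1 pebbles from v to an in-neighbour u (arc u → v)
shiftBack : ∀ {n} → Fin n → Fin n → ℕ → Position n → Position n
shiftBack u v k p = let q = set v (p v ∸ k) p in set u (q u + k) q

-- (2) remove two pebbles from v and place one on an out-neighbour w (arc v → w)
payForward : ∀ {n} → Fin n → Fin n → Position n → Position n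
payForward v w p = let q = set v (p v ∸ 2) p in set w (q w + 1) q

data Move {n} (G : Digraph n) (p : Position n) : Position n → Set where
  moveBack : (u v : Fin n) (k : ℕ) → G u v → 1 ≤ k → k ≤ p v →
             Move G p (shiftBack u v k p)
  moveForward : (v w : Fin n) → G v w → 2 ≤ p v →
                Move G p (payForward v w p)

-- Normal play outcome classes, defined inductively (the game is finite on a DAG):
-- P: every move leads to an N-position (previous player wins);
-- N: some move leads to a P-position (next player wins).
mutual
  data IsP {n} (G : Digraph n) (p : Position n) : Set where
    allToN : (∀ q → Move G p q → IsN G q) → IsP G p

  data IsN {n} (G : Digraph n) (p : Position n) : Set where
    someToP : (q : Position n) → Move G p q → IsP G q → IsN G p

-- The transitive triple: x = 0, y = 1, z = 2 with arcs x→y, y→z, x→z.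
data TransTripleArc : Fin 3 → Fin 3 → Set where
  x→y : TransTripleArc zero (suc zero)
  y→z : TransTripleArc (suc zero) (suc (suc zero))
  x→z : TransTripleArc zero (suc (suc zero))

triplePos : ℕ → ℕ → ℕ → Position 3
triplePos g₁ g₂ g₃ zero = g₁
triplePos g₁ g₂ g₃ (suc zero) = g₂
triplePos g₁ g₂ g₃ (suc (suc zero)) = g₃

-- The positions with equally many pebbles on y and z form a kernel of the move graph: every move
-- from such a position destroys the balance (it changes exactly one of the two counts,
-- or raises one while lowering the other), while from an unbalanced position the surplus on y or
-- on z can be shifted back to the source x. The game is finite because the potential
-- 4x + 5y + 6z strictly decreases along every move: weights increase along arcs, so shifting
-- pebbles back costs weight, but by less than a factor two, so paying two pebbles for one costs
-- weight as well.
module Submission where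

open import Defs
open import Data.Nat using (ℕ; zero; suc; _+_; _*_; _∸_; _≤_; _<_; z≤n; s≤s; >-nonZero)
open import Data.Nat.Properties renaming (_≟_ to _≟ℕ_)
open import Data.Fin using (Fin; zero; suc; _≟_)
open import Data.Product using (∃-syntax; _×_; _,_)
open import Data.Nat.Induction using (<-wellFounded)
open import Induction.WellFounded using (Acc; acc)
open import Function using (_∘_)
open import Function.Bundles using (_⇔_; mk⇔)
open import Relation.Nullary using (¬_; Dec; yes; no; contradiction)
open import Relation.Binary.Definitions using (tri<; tri≈; tri>)
open import Relation.Binary.PropositionalEquality
  using (_≡_; refl; sym; cong; cong₂; module ≡-Reasoning)

set-suc : ∀ {n} (v x : Fin n) m p → set (suc v) m p (suc x) ≡ set v m (p ∘ suc) x
set-suc v x m p with x ≟ v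
... | yes _ = refl
... | no  _ = refl

weighted : ∀ {n} → (Fin n → ℕ) → Position n → ℕ
weighted {zero}  w p = 0
weighted {suc n} w p = w zero * p zero + weighted (w ∘ suc) (p ∘ suc)

weighted-cong : ∀ {n} (w : Fin n → ℕ) {p q : Position n} →
                (∀ x → p x ≡ q x) → weighted w p ≡ weighted w q
weighted-cong {zero}  w eq = refl
weighted-cong {suc n} w eq =
  cong₂ _+_ (cong (w zero *_) (eq zero)) (weighted-cong (w ∘ suc) (eq ∘ suc))

weighted-set : ∀ {n} (w : Fin n → ℕ) (v : Fin n) m p →
               weighted w (set v m p) + w v * p v ≡ weighted w p + w v * m
weighted-set w zero m p =
  swap-outer (w zero * m) (weighted (w ∘ suc) (p ∘ suc)) (w zero * p zero)
  where
  swap-outer : ∀ a t b → a + t + b ≡ b + t + a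
  swap-outer a t b = begin
    a + t + b   ≡⟨ +-comm (a + t) b ⟩
    b + (a + t) ≡⟨ cong (b +_) (+-comm a t) ⟩
    b + (t + a) ≡⟨ +-assoc b t a ⟨
    b + t + a   ∎
    where open ≡-Reasoning
weighted-set w (suc v) m p = begin
  h + weighted w′ (set (suc v) m p ∘ suc) + w (suc v) * p (suc v)
    ≡⟨ cong (λ t → h + t + w (suc v) * p (suc v)) (weighted-cong w′ λ x → set-suc v x m p) ⟩
  h + weighted w′ (set v m (p ∘ suc)) + w (suc v) * p (suc v)
    ≡⟨ +-assoc h _ _ ⟩
  h + (weighted w′ (set v m (p ∘ suc)) + w (suc v) * p (suc v))
    ≡⟨ cong (h +_) (weighted-set w′ v m (p ∘ suc)) ⟩
  h + (weighted w′ (p ∘ suc) + w (suc v) * m)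
    ≡⟨ +-assoc h _ _ ⟨
  h + weighted w′ (p ∘ suc) + w (suc v) * m
    ∎
  where
  open ≡-Reasoning
  h  = w zero * p zero
  w′ = w ∘ suc

weighted-set-+ : ∀ {n} (w : Fin n → ℕ) (v : Fin n) b p →
                 weighted w (set v (p v + b) p) ≡ weighted w p + w v * b
weighted-set-+ w v b p = +-cancelʳ-≡ (w v * p v) _ _ (begin
  weighted w (set v (p v + b) p) + w v * p v ≡⟨ weighted-set w v (p v + b) p ⟩
  weighted w p + w v * (p v + b)             ≡⟨ cong (weighted w p +_) (*-distribˡ-+ (w v) (p v) b) ⟩
  weighted w p + (w v * p v + w v * b)       ≡⟨ cong (weighted w p +_) (+-comm (w v * p v) _) ⟩
  weighted w p + (w v * b + w v * p v)       ≡⟨ +-assoc (weighted w p) _ _ ⟨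
  weighted w p + w v * b + w v * p v         ∎)
  where open ≡-Reasoning

weighted-set-∸ : ∀ {n} (w : Fin n → ℕ) (v : Fin n) {a} p → a ≤ p v →
                 weighted w (set v (p v ∸ a) p) + w v * a ≡ weighted w p
weighted-set-∸ w v {a} p a≤pv = +-cancelʳ-≡ (w v * (p v ∸ a)) _ _ (begin
  weighted w q + w v * a + w v * (p v ∸ a)   ≡⟨ +-assoc (weighted w q) _ _ ⟩
  weighted w q + (w v * a + w v * (p v ∸ a)) ≡⟨ cong (weighted w q +_) (*-distribˡ-+ (w v) a _) ⟨
  weighted w q + w v * (a + (p v ∸ a))       ≡⟨ cong (λ m → weighted w q + w v * m) (m+[n∸m]≡n a≤pv) ⟩
  weighted w q + w v * p v                   ≡⟨ weighted-set w v (p v ∸ a) p ⟩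
  weighted w p + w v * (p v ∸ a)             ∎)
  where
  open ≡-Reasoning
  q = set v (p v ∸ a) p

-- shiftBack and payForward both have this shape: take a pebbles off v, then put b pebbles on u.
weighted-transfer : ∀ {n} (w : Fin n → ℕ) (u v : Fin n) {a} b p → a ≤ p v →
                    let q = set v (p v ∸ a) p in
                    weighted w (set u (q u + b) q) + w v * a ≡ weighted w p + w u * b
weighted-transfer w u v {a} b p a≤pv = begin
  weighted w (set u (q u + b) q) + w v * a ≡⟨ cong (_+ w v * a) (weighted-set-+ w u b q) ⟩
  weighted w q + w u * b + w v * a         ≡⟨ +-assoc (weighted w q) _ _ ⟩
  weighted w q + (w u * b + w v * a)       ≡⟨ cong (weighted w q +_) (+-comm (w u * b) _) ⟩
  weighted w q + (w v * a + w u * b)       ≡⟨ +-assoc (weighted w q) _ _ ⟨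
  weighted w q + w v * a + w u * b         ≡⟨ cong (_+ w u * b) (weighted-set-∸ w v p a≤pv) ⟩
  weighted w p + w u * b                   ∎
  where
  open ≡-Reasoning
  q = set v (p v ∸ a) p

m+o≡n+p∧p<o⇒m<n : ∀ {m n o p} → m + o ≡ n + p → p < o → m < n
m+o≡n+p∧p<o⇒m<n {m} {n} {o} {p} eq p<o =
  +-cancelʳ-< o m n (≤-<-trans (≤-reflexive eq) (+-monoʳ-< n p<o))

weighted-decreasing : ∀ {n} {G : Digraph n} (w : Fin n → ℕ) →
                      (∀ {u v} → G u v → w u < w v) →
                      (∀ {u v} → G u v → w v < 2 * w u) →
                      ∀ {p q} → Move G p q → weighted w q < weighted w p
weighted-decreasing w increasing _ {p} (moveBack u v k uv 1≤k k≤pv) =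
  m+o≡n+p∧p<o⇒m<n (weighted-transfer w u v k p k≤pv)
    (*-monoˡ-< k ⦃ >-nonZero 1≤k ⦄ (increasing uv))
weighted-decreasing w _ subdoubling {p} (moveForward v u vu 2≤pv) =
  m+o≡n+p∧p<o⇒m<n (weighted-transfer w u v 1 p 2≤pv) (begin-strict
    w u * 1 ≡⟨ *-identityʳ (w u) ⟩
    w u     <⟨ subdoubling vu ⟩
    2 * w v ≡⟨ *-comm 2 (w v) ⟩
    w v * 2 ∎)
  where open ≤-Reasoning

IsN⇒¬IsP : ∀ {n} {G : Digraph n} {p} → IsN G p → ¬ IsP G p
IsN⇒¬IsP (someToP q p→q q-P) (allToN all-N) = IsN⇒¬IsP (all-N q p→q) q-P

module Kernel {n} {G : Digraph n}
  (μ : Position n → ℕ) (μ-decreasing : ∀ {p q} → Move G p q → μ q < μ p)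
  {K : Position n → Set} (K? : ∀ p → Dec (K p))
  (K-independent : ∀ {p q} → Move G p q → K p → ¬ K q)
  (K-absorbing : ∀ {p} → ¬ K p → ∃[ q ] Move G p q × K q)
  where

  mutual
    K⇒IsP : ∀ {p} → Acc _<_ (μ p) → K p → IsP G p
    K⇒IsP (acc rs) p∈K =
      allToN λ q p→q → ¬K⇒IsN (rs (μ-decreasing p→q)) (K-independent p→q p∈K)

    ¬K⇒IsN : ∀ {p} → Acc _<_ (μ p) → ¬ K p → IsN G p
    ¬K⇒IsN (acc rs) p∉K with K-absorbing p∉K
    ... | q , p→q , q∈K = someToP q p→q (K⇒IsP (rs (μ-decreasing p→q)) q∈K)

  IsP⇔K : ∀ p → IsP G p ⇔ K p
  IsP⇔K p = mk⇔ IsP⇒K (K⇒IsP (<-wellFounded (μ p)))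
    where
    IsP⇒K : IsP G p → K p
    IsP⇒K p-P with K? p
    ... | yes p∈K = p∈K
    ... | no  p∉K = contradiction p-P (IsN⇒¬IsP (¬K⇒IsN (<-wellFounded (μ p)) p∉K))

tripleWeight : Fin 3 → ℕ
tripleWeight zero             = 4
tripleWeight (suc zero)       = 5
tripleWeight (suc (suc zero)) = 6

tripleWeight-increasing : ∀ {u v} → TransTripleArc u v → tripleWeight u < tripleWeight v
tripleWeight-increasing x→y = ≤-refl
tripleWeight-increasing y→z = ≤-refl
tripleWeight-increasing x→z = m<m+n 4 (s≤s z≤n)

tripleWeight-subdoubling : ∀ {u v} → TransTripleArc u v → tripleWeight v < 2 * tripleWeight u
tripleWeight-subdoubling x→y = m<m+n 5 (s≤s z≤n)
tripleWeight-subdoubling y→z = m<m+n 6 (s≤s z≤n)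
tripleWeight-subdoubling x→z = m<m+n 6 (s≤s z≤n)

onY onZ : Position 3 → ℕ
onY p = p (suc zero)
onZ p = p (suc (suc zero))

Balanced : Position 3 → Set
Balanced p = onY p ≡ onZ p

balanced-independent : ∀ {p q} → Move TransTripleArc p q → Balanced p → ¬ Balanced q
balanced-independent (moveBack _ _ k x→y 1≤k k≤y) y≡z =
  <⇒≢ (≤-trans (∸-monoʳ-< 1≤k k≤y) (≤-reflexive y≡z))
balanced-independent {p} (moveBack _ _ k y→z 1≤k k≤z) y≡z =
  >⇒≢ (≤-<-trans (m∸n≤m _ k) (≤-<-trans (≤-reflexive (sym y≡z)) (m<m+n (onY p) 1≤k)))
balanced-independent (moveBack _ _ k x→z 1≤k k≤z) y≡z =
  >⇒≢ (<-≤-trans (∸-monoʳ-< 1≤k k≤z) (≤-reflexive (sym y≡z)))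
balanced-independent (moveForward _ _ x→y _) y≡z =
  >⇒≢ (≤-<-trans (≤-reflexive (sym y≡z)) (m<m+n _ (s≤s z≤n)))
balanced-independent (moveForward _ _ y→z 2≤y) y≡z =
  <⇒≢ (≤-<-trans (m∸n≤m _ 2) (≤-<-trans (≤-reflexive y≡z) (m<m+n _ (s≤s z≤n))))
balanced-independent (moveForward _ _ x→z _) y≡z =
  <⇒≢ (≤-<-trans (≤-reflexive y≡z) (m<m+n _ (s≤s z≤n)))

balanced-absorbing : ∀ {p} → ¬ Balanced p → ∃[ q ] Move TransTripleArc p q × Balanced q
balanced-absorbing {p} y≢z with <-cmp (onY p) (onZ p)
... | tri< y<z _ _ =
  _ , moveBack zero (suc (suc zero)) (onZ p ∸ onY p) x→z (m<n⇒0<n∸m y<z) (m∸n≤m (onZ p) (onY p))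
    , sym (m∸[m∸n]≡n (<⇒≤ y<z))
... | tri≈ _ y≡z _ = contradiction y≡z y≢z
... | tri> _ _ y>z =
  _ , moveBack zero (suc zero) (onY p ∸ onZ p) x→y (m<n⇒0<n∸m y>z) (m∸n≤m (onY p) (onZ p))
    , m∸[m∸n]≡n (<⇒≤ y>z)

open Kernel (weighted tripleWeight)
  (weighted-decreasing tripleWeight tripleWeight-increasing tripleWeight-subdoubling)
  (λ p → onY p ≟ℕ onZ p) balanced-independent balanced-absorbing
  renaming (IsP⇔K to IsP⇔Balanced)

theorem9 : (g₁ g₂ g₃ : ℕ) → IsP TransTripleArc (triplePos g₁ g₂ g₃) ⇔ (g₂ ≡ g₃)
theorem9 g₁ g₂ g₃ = IsP⇔Balanced (triplePos g₁ g₂ g₃)
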